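{- If $H$ is $5$-Ore and $v\in V(H)$, then there exists either an Ore-collapsible subset of $V(H)$ not containing $v$ or an emerald of $H$ not containing $v$.
   Context: All graphs are finite and simple. An Ore-composition of $G_1$ and $G_2$: delete an edge $xy$ of $G_1$, split a vertex $z$ of $G_2$ into two vertices $z_1,z_2$ of positive degree, identify $x$ with $z_1$ and $y$ with $z_2$. A graph is $5$-Ore if obtainable from copies of $K_5$ by repeated Ore-compositions. An emerald in a graph $G$ is a subgraph isomorphic to $K_4$ all of whose vertices have degree four in $G$. The boundary of $R\subseteq V(G)$ is the set of vertices of $R$ with a neighbor outside $R$. An Ore-collapsible subset of $V(G)$ is a proper subset $R$ whose boundary consists of exactly two non-adjacent vertices $u,v$ such that $G[R]+uv$ is $5$-Ore. -}

module Defs where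

open import Data.Nat using (ℕ; zero; suc; _+_)
open import Data.Fin using (Fin; _≟_)
open import Data.Bool using (Bool; true; false; _∧_; _∨_; not; if_then_else_)
open import Data.List using (List; map; allFin)
open import Data.Nat.ListAction using (sum)
open import Data.Sum using (_⊎_; inj₁; inj₂)
open import Data.Product using (Σ; ∃; _×_; _,_)
open import Relation.Nullary using (¬_; does)
open import Relation.Binary.PropositionalEquality using (_≡_; _≢_)

record Graph : Set where
  field
    n     : ℕ
    E     : Fin n → Fin n → Bool
    sym   : ∀ u v → E u v ≡ E v u
    irr   : ∀ u → E u u ≡ false
open Graph public

_==_ : ∀ {k} → Fin k → Fin k → Bool
a == b = does (a ≟ b)

deg : (G : Graph) → Fin (n G) → ℕ
deg G v = sum (map (λ w → if E G v w then 1 else 0) (allFin (n G)))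

-- Adjacency of the Ore-composition on the vertex set V(G1) ⊎ V(G2)
-- (the vertex inj₂ z is not used).  The edge xy of G1 is deleted, z is
-- split into z1 = x (receiving the neighbours w of z with side w = true)
-- and z2 = y (receiving the neighbours w of z with side w = false).
oreAdj : (G₁ G₂ : Graph) (x y : Fin (n G₁)) (z : Fin (n G₂))
         (side : Fin (n G₂) → Bool) →
         Fin (n G₁) ⊎ Fin (n G₂) → Fin (n G₁) ⊎ Fin (n G₂) → Bool
oreAdj G₁ G₂ x y z side (inj₁ a) (inj₁ b) =
  E G₁ a b ∧ not ((a == x ∧ b == y) ∨ (a == y ∧ b == x))
oreAdj G₁ G₂ x y z side (inj₂ a) (inj₂ b) = E G₂ a b
oreAdj G₁ G₂ x y z side (inj₁ a) (inj₂ b) =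
  E G₂ z b ∧ ((a == x ∧ side b) ∨ (a == y ∧ not (side b)))
oreAdj G₁ G₂ x y z side (inj₂ b) (inj₁ a) =
  E G₂ z b ∧ ((a == x ∧ side b) ∨ (a == y ∧ not (side b)))

record OreComposition (G₁ G₂ G : Graph) : Set where
  field
    x y    : Fin (n G₁)
    xy     : E G₁ x y ≡ true
    z      : Fin (n G₂)
    side   : Fin (n G₂) → Bool
    z₁pos  : ∃ λ w → E G₂ z w ≡ true × side w ≡ true
    z₂pos  : ∃ λ w → E G₂ z w ≡ true × side w ≡ false
    f      : Fin (n G) → Fin (n G₁) ⊎ Fin (n G₂)
    f-inj  : ∀ u v → f u ≡ f v → u ≡ v
    f-avoid : ∀ u → f u ≢ inj₂ z
    f-surj : ∀ t → t ≢ inj₂ z → ∃ λ u → f u ≡ t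
    f-adj  : ∀ u v → E G u v ≡ oreAdj G₁ G₂ x y z side (f u) (f v)

data Ore5 : Graph → Set where
  k5  : (G : Graph) → n G ≡ 5 →
        (∀ u v → u ≢ v → E G u v ≡ true) → Ore5 G
  ore : (G₁ G₂ G : Graph) → Ore5 G₁ → Ore5 G₂ →
        OreComposition G₁ G₂ G → Ore5 G

record Emerald (G : Graph) : Set where
  field
    vtx     : Fin 4 → Fin (n G)
    vtx-inj : ∀ i j → vtx i ≡ vtx j → i ≡ j
    clique  : ∀ i j → i ≢ j → E G (vtx i) (vtx j) ≡ true
    deg4    : ∀ i → deg G (vtx i) ≡ 4

Boundary : (G : Graph) → (Fin (n G) → Bool) → Fin (n G) → Set
Boundary G R w = R w ≡ true × ∃ λ w' → R w' ≡ false × E G w w' ≡ true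

record OreCollapsible (G : Graph) (R : Fin (n G) → Bool) : Set where
  field
    proper   : ∃ λ w → R w ≡ false
    u v      : Fin (n G)
    u≢v      : u ≢ v
    nonadj   : E G u v ≡ false
    bd-u     : Boundary G R u
    bd-v     : Boundary G R v
    bd-only  : ∀ w → Boundary G R w → w ≡ u ⊎ w ≡ v
    -- G[R] + uv is 5-Ore: a 5-Ore graph H with a bijection g onto R
    H        : Graph
    H-ore    : Ore5 H
    g        : Fin (n H) → Fin (n G)
    g-inj    : ∀ a b → g a ≡ g b → a ≡ b
    g-in     : ∀ a → R (g a) ≡ true
    g-surj   : ∀ w → R w ≡ true → ∃ λ a → g a ≡ w
    g-adj    : ∀ a b → E H a b ≡
                 (E G (g a) (g b) ∨ ((g a == u ∧ g b == v) ∨ (g a == v ∧ g b == u)))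

module Submission where

-- Proof by induction on the construction of the 5-Ore graph H.
--
-- * H = K₅: the four vertices other than v form an emerald, since every
--   vertex of K₅ has degree 4.
-- * H is the Ore-composition of G₁ (edge xy deleted) and G₂ (vertex z
--   split).  If v comes from the G₂ side, the G₁ side R₁ is Ore-collapsible:
--   its boundary is {x, y}, and H[R₁] + xy is G₁ itself.  If v comes from the
--   G₁ side, apply the induction hypothesis to G₂ and z.  A vertex c ≠ z of
--   G₂ has the same neighbourhood in H as in G₂ (a neighbour z is replaced by
--   the copy of z attached to c), so an emerald of G₂ avoiding z, or an
--   Ore-collapsible set of G₂ avoiding z, is carried over to H unchanged,
--   and it avoids v because v lies on the G₁ side.

open import Defs hiding (sym)
open import Data.Nat using (ℕ; zero; suc; pred; _+_; _≤_; z≤n; s≤s)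
open import Data.Nat.Properties using (≤-antisym; +-suc)
open import Data.Fin using (Fin; _≟_; punchIn) renaming (zero to fz; suc to fs)
open import Data.Fin.Properties using (punchIn-injective; punchInᵢ≢i; suc-injective)
open import Data.Bool using (Bool; true; false; _∧_; _∨_; not; if_then_else_)
open import Data.Bool.Properties using (∧-identityʳ; ∧-zeroʳ; ∨-identityʳ; if-float)
open import Data.List using (tabulate)
open import Data.List.Properties using (map-tabulate; tabulate-cong)
open import Data.Nat.ListAction using (sum)
open import Data.Sum using (_⊎_; inj₁; inj₂) renaming (map to ⊎-map)
open import Data.Sum.Properties using (inj₁-injective; inj₂-injective)
open import Data.Product using (Σ; ∃; _×_; _,_; proj₁; proj₂)
open import Function using (_∘_; id)
open import Relation.Nullary using (yes; no)
open import Data.Empty using (⊥-elim)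
open import Relation.Nullary.Decidable using (dec-true; dec-false)
open import Relation.Binary.PropositionalEquality
  using (_≡_; _≢_; refl; sym; trans; cong; cong₂; subst; subst₂; module ≡-Reasoning)

∧-true : ∀ {a b} → a ∧ b ≡ true → a ≡ true × b ≡ true
∧-true {true} {true} refl = refl , refl

∨-true : ∀ {a b} → a ∨ b ≡ true → a ≡ true ⊎ b ≡ true
∨-true {true}  refl = inj₁ refl
∨-true {false} refl = inj₂ refl

restore-deleted : ∀ e c → (c ≡ true → e ≡ true) → e ≡ (e ∧ not c) ∨ c
restore-deleted e     false _      = sym (trans (cong (_∨ false) (∧-identityʳ e)) (∨-identityʳ e))
restore-deleted true  true  _      = refl
restore-deleted false true  c⇒e    = c⇒e refl

select : ∀ s p q → (p ∧ s) ∨ (q ∧ not s) ≡ (if s then p else q)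
select true  p q = trans (cong₂ _∨_ (∧-identityʳ p) (∧-zeroʳ q)) (∨-identityʳ p)
select false p q = cong₂ _∨_ (∧-zeroʳ p) (∧-identityʳ q)

==-refl : ∀ {k} (a : Fin k) → (a == a) ≡ true
==-refl a = dec-true (a ≟ a) refl

==-sound : ∀ {k} {a b : Fin k} → (a == b) ≡ true → a ≡ b
==-sound {a = a} {b} eq with a ≟ b | eq
... | yes a≡b | _ = a≡b
... | no _    | ()

==-transport : ∀ {k m} {a b : Fin k} {a' b' : Fin m} →
               (a' ≡ b' → a ≡ b) → (a ≡ b → a' ≡ b') → (a' == b') ≡ (a == b)
==-transport {a = a} {b} {a'} {b'} to from with a ≟ b
... | yes a≡b = dec-true  (a' ≟ b') (from a≡b)
... | no  a≢b = dec-false (a' ≟ b') (a≢b ∘ to)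

adjacent⇒distinct : (G : Graph) {a b : Fin (n G)} → E G a b ≡ true → a ≢ b
adjacent⇒distinct G {a} ab refl with trans (sym (irr G a)) ab
... | ()

boundary⇒proper : (G : Graph) (R : Fin (n G) → Bool) {w : Fin (n G)} →
                  Boundary G R w → ∃ λ w' → R w' ≡ false
boundary⇒proper G R (_ , w' , outR , _) = w' , outR

indicator : Bool → ℕ
indicator b = if b then 1 else 0

count : (m : ℕ) → (Fin m → Bool) → ℕ
count m P = sum (tabulate (indicator ∘ P))

deg≡count : (G : Graph) (v : Fin (n G)) → deg G v ≡ count (n G) (E G v)
deg≡count G v = cong sum (map-tabulate id (λ w → indicator (E G v w)))

count-cong : ∀ m {P Q : Fin m → Bool} → (∀ i → P i ≡ Q i) → count m P ≡ count m Q
count-cong m P≗Q = cong sum (tabulate-cong (cong indicator ∘ P≗Q))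

count-all : ∀ m → count m (λ _ → true) ≡ m
count-all zero    = refl
count-all (suc m) = cong suc (count-all m)

count-remove : ∀ m (Q : Fin m → Bool) (a : Fin m) → Q a ≡ true →
               count m Q ≡ suc (count m (λ i → Q i ∧ not (i == a)))
count-remove (suc m) Q fz Qa rewrite Qa =
  cong suc (count-cong m (λ i → sym (∧-identityʳ (Q (fs i)))))
count-remove (suc m) Q (fs a) Qa = begin
  indicator (Q fz) + count m (Q ∘ fs)
    ≡⟨ cong (indicator (Q fz) +_) (count-remove m (Q ∘ fs) a Qa) ⟩
  indicator (Q fz) + suc rest
    ≡⟨ +-suc (indicator (Q fz)) rest ⟩
  suc (indicator (Q fz) + rest)
    ≡⟨ cong (λ b → suc (indicator b + rest)) (sym (∧-identityʳ (Q fz))) ⟩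
  suc (indicator (Q fz ∧ true) + rest) ∎
  where
  open ≡-Reasoning
  rest : ℕ
  rest = count m (λ i → Q (fs i) ∧ not (i == a))

count-injection : ∀ m k (P : Fin m → Bool) (Q : Fin k → Bool)
                  (φ : ∀ i → P i ≡ true → Fin k) →
                  (∀ i p → Q (φ i p) ≡ true) →
                  (∀ i j p q → φ i p ≡ φ j q → i ≡ j) →
                  count m P ≤ count k Q
count-injection zero    k P Q φ φ-in φ-inj = z≤n
count-injection (suc m) k P Q φ φ-in φ-inj with P fz in P0
... | false = count-injection m k (P ∘ fs) Q (φ ∘ fs) (φ-in ∘ fs)
                (λ i j p q → suc-injective ∘ φ-inj (fs i) (fs j) p q)
... | true  = subst (suc (count m (P ∘ fs)) ≤_)
                (sym (count-remove k Q (φ fz P0) (φ-in fz P0)))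
                (s≤s (count-injection m k (P ∘ fs) Q′ (φ ∘ fs) φ-in′
                       (λ i j p q → suc-injective ∘ φ-inj (fs i) (fs j) p q)))
  where
  Q′ : Fin k → Bool
  Q′ j = Q j ∧ not (j == φ fz P0)
  -- no later element is sent where fz went
  φ-in′ : ∀ i p → Q′ (φ (fs i) p) ≡ true
  φ-in′ i p = cong₂ _∧_ (φ-in (fs i) p)
                (cong not (dec-false (φ (fs i) p ≟ φ fz P0) (λ e → fs≢fz (φ-inj _ _ p P0 e))))
    where fs≢fz : fs i ≢ fz
          fs≢fz ()

complete-deg : (G : Graph) → (∀ u w → u ≢ w → E G u w ≡ true) →
               ∀ w → suc (deg G w) ≡ n G
complete-deg G complete w = begin
  suc (deg G w)                                         ≡⟨ cong suc (deg≡count G w) ⟩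
  suc (count (n G) (E G w))                             ≡⟨ cong suc (count-cong (n G) non-loop) ⟩
  suc (count (n G) (λ u → true ∧ not (u == w)))         ≡⟨ sym (count-remove (n G) _ w refl) ⟩
  count (n G) (λ _ → true)                              ≡⟨ count-all (n G) ⟩
  n G ∎
  where
  open ≡-Reasoning
  non-loop : ∀ u → E G w u ≡ not (u == w)
  non-loop u with u ≟ w
  ... | yes refl = irr G u
  ... | no  u≢w  = complete w u (u≢w ∘ sym)

K₅-emerald : (G : Graph) → n G ≡ 5 → (∀ u w → u ≢ w → E G u w ≡ true) →
             (v : Fin (n G)) → Σ (Emerald G) λ K → ∀ i → Emerald.vtx K i ≢ v
K₅-emerald G@record { n = .5 } refl complete v =
  record { vtx     = punchIn v
         ; vtx-inj = punchIn-injective v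
         ; clique  = λ i j i≢j → complete _ _ (i≢j ∘ punchIn-injective v i j)
         ; deg4    = λ i → cong pred (complete-deg G complete (punchIn v i)) }
  , punchInᵢ≢i v

fromLeft : ∀ {A B : Set} → A ⊎ B → Bool
fromLeft (inj₁ _) = true
fromLeft (inj₂ _) = false

module Composition {G₁ G₂ G : Graph} (C : OreComposition G₁ G₂ G) where
  open OreComposition C

  V : Set
  V = Fin (n G₁) ⊎ Fin (n G₂)

  Adj : V → V → Bool
  Adj = oreAdj G₁ G₂ x y z side

  port : Fin (n G₂) → Fin (n G₁)
  port b = if side b then x else y

  port-cases : ∀ b → port b ≡ x ⊎ port b ≡ y
  port-cases b with side b
  ... | true  = inj₁ refl
  ... | false = inj₂ refl

  cross-adj : ∀ a b → Adj (inj₁ a) (inj₂ b) ≡ E G₂ z b ∧ (a == port b)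
  cross-adj a b = cong (E G₂ z b ∧_)
    (trans (select (side b) (a == x) (a == y)) (sym (if-float (a ==_) (side b))))

  cross-edge : ∀ {a b} → Adj (inj₁ a) (inj₂ b) ≡ true → E G₂ z b ≡ true × a ≡ port b
  cross-edge {a} {b} edge with ∧-true {E G₂ z b} (trans (sym (cross-adj a b)) edge)
  ... | zb , a≡port = zb , ==-sound a≡port

  port-adj : ∀ b → E G₂ z b ≡ true → Adj (inj₁ (port b)) (inj₂ b) ≡ true
  port-adj b zb = trans (cross-adj (port b) b) (cong₂ _∧_ zb (==-refl (port b)))

  deleted : Fin (n G₁) → Fin (n G₁) → Bool
  deleted a b = (a == x ∧ b == y) ∨ (a == y ∧ b == x)

  deleted⇒edge : ∀ a b → deleted a b ≡ true → E G₁ a b ≡ true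
  deleted⇒edge a b del with ∨-true {a == x ∧ b == y} del
  ... | inj₁ xy-pair with ∧-true {a == x} xy-pair
  ...   | ax , by = subst₂ (λ s t → E G₁ s t ≡ true) (sym (==-sound ax)) (sym (==-sound by)) xy
  deleted⇒edge a b del | inj₂ yx-pair with ∧-true {a == y} yx-pair
  ...   | ay , bx = subst₂ (λ s t → E G₁ s t ≡ true) (sym (==-sound ay)) (sym (==-sound bx))
                      (trans (Graph.sym G₁ y x) xy)

  x≢y : x ≢ y
  x≢y = adjacent⇒distinct G₁ xy

  xy-deleted : Adj (inj₁ x) (inj₁ y) ≡ false
  xy-deleted rewrite ==-refl x | ==-refl y = ∧-zeroʳ (E G₁ x y)

  vertex : (t : V) → t ≢ inj₂ z → Fin (n G)
  vertex t t≢z = proj₁ (f-surj t t≢z)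

  f-vertex : ∀ t t≢z → f (vertex t t≢z) ≡ t
  f-vertex t t≢z = proj₂ (f-surj t t≢z)

  f-unique : ∀ {u w t} → f u ≡ t → f w ≡ t → u ≡ w
  f-unique fu fw = f-inj _ _ (trans fu (sym fw))

  E-via : ∀ {u w t s} → f u ≡ t → f w ≡ s → E G u w ≡ Adj t s
  E-via {u} {w} fu fw = trans (f-adj u w) (cong₂ Adj fu fw)

  ι₁ : Fin (n G₁) → Fin (n G)
  ι₁ a = vertex (inj₁ a) (λ ())

  ι₂ : (b : Fin (n G₂)) → b ≢ z → Fin (n G)
  ι₂ b b≢z = vertex (inj₂ b) (b≢z ∘ inj₂-injective)

  f-ι₁ : ∀ a → f (ι₁ a) ≡ inj₁ a
  f-ι₁ a = f-vertex (inj₁ a) (λ ())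

  f-ι₂ : ∀ b b≢z → f (ι₂ b b≢z) ≡ inj₂ b
  f-ι₂ b b≢z = f-vertex (inj₂ b) (b≢z ∘ inj₂-injective)

  ι₁-injective : ∀ {a b} → ι₁ a ≡ ι₁ b → a ≡ b
  ι₁-injective {a} {b} e = inj₁-injective (trans (sym (f-ι₁ a)) (trans (cong f e) (f-ι₁ b)))

  ι₂-injective : ∀ {a b} a≢z b≢z → ι₂ a a≢z ≡ ι₂ b b≢z → a ≡ b
  ι₂-injective {a} {b} a≢z b≢z e =
    inj₂-injective (trans (sym (f-ι₂ a a≢z)) (trans (cong f e) (f-ι₂ b b≢z)))

  ι₁-== : ∀ a b → (ι₁ a == ι₁ b) ≡ (a == b)
  ι₁-== a b = ==-transport ι₁-injective (cong ι₁)

  ι₂-== : ∀ a b a≢z b≢z → (ι₂ a a≢z == ι₂ b b≢z) ≡ (a == b)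
  ι₂-== a b a≢z b≢z =
    ==-transport (ι₂-injective a≢z b≢z) λ { refl → f-unique (f-ι₂ a a≢z) (f-ι₂ a b≢z) }

  ι₁-of : ∀ {w a} → f w ≡ inj₁ a → w ≡ ι₁ a
  ι₁-of {a = a} fw = f-unique fw (f-ι₁ a)

  ι₂-of : ∀ {w b} (b≢z : b ≢ z) → f w ≡ inj₂ b → w ≡ ι₂ b b≢z
  ι₂-of b≢z fw = f-unique fw (f-ι₂ _ b≢z)

  R₁ : Fin (n G) → Bool
  R₁ w = fromLeft (f w)

  port-boundary : ∀ b → E G₂ z b ≡ true → Boundary G R₁ (ι₁ (port b))
  port-boundary b zb =
    cong fromLeft (f-ι₁ (port b)) , ι₂ b b≢z , cong fromLeft (f-ι₂ b b≢z) , edge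
    where
    b≢z : b ≢ z
    b≢z = adjacent⇒distinct G₂ zb ∘ sym
    edge : E G (ι₁ (port b)) (ι₂ b b≢z) ≡ true
    edge = trans (E-via (f-ι₁ (port b)) (f-ι₂ b b≢z)) (port-adj b zb)

  -- Each copy of z keeps a neighbour on the G₂ side (z was split into two
  -- vertices of positive degree), so it is a boundary vertex of R₁.
  copy-boundary : ∀ {s} → (∃ λ w → E G₂ z w ≡ true × side w ≡ s) →
                  Boundary G R₁ (ι₁ (if s then x else y))
  copy-boundary (w , zw , refl) = port-boundary w zw

  R₁-boundary : ∀ w → Boundary G R₁ w → w ≡ ι₁ x ⊎ w ≡ ι₁ y
  R₁-boundary w (inR , w' , outR , ww')
    with f w in fw | f w' in fw' | trans (sym (f-adj w w')) ww'
  R₁-boundary w (inR , w' , outR , ww') | inj₁ a | inj₂ b | edge =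
    ⊎-map at-ι₁ at-ι₁ (port-cases b)
    where
    at-ι₁ : ∀ {c} → port b ≡ c → w ≡ ι₁ c
    at-ι₁ port≡c = trans (ι₁-of fw) (cong ι₁ (trans (proj₂ (cross-edge edge)) port≡c))
  R₁-boundary w (inR , w' , () , ww') | inj₁ a | inj₁ a' | _
  R₁-boundary w (() , w' , outR , ww') | inj₂ b | _ | _

  R₁-surjective : ∀ w → R₁ w ≡ true → ∃ λ a → ι₁ a ≡ w
  R₁-surjective w inR with f w in fw
  R₁-surjective w inR  | inj₁ a = a , sym (ι₁-of fw)
  R₁-surjective w () | inj₂ b

  -- G[R₁] + xy is G₁.
  G₁-adj : ∀ a b → E G₁ a b ≡
    (E G (ι₁ a) (ι₁ b) ∨ ((ι₁ a == ι₁ x ∧ ι₁ b == ι₁ y) ∨ (ι₁ a == ι₁ y ∧ ι₁ b == ι₁ x)))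
  G₁-adj a b = begin
    E G₁ a b
      ≡⟨ restore-deleted (E G₁ a b) (deleted a b) (deleted⇒edge a b) ⟩
    Adj (inj₁ a) (inj₁ b) ∨ deleted a b
      ≡⟨ cong₂ _∨_ (sym (E-via (f-ι₁ a) (f-ι₁ b)))
                   (sym (cong₂ _∨_ (cong₂ _∧_ (ι₁-== a x) (ι₁-== b y))
                                   (cong₂ _∧_ (ι₁-== a y) (ι₁-== b x)))) ⟩
    E G (ι₁ a) (ι₁ b) ∨ ((ι₁ a == ι₁ x ∧ ι₁ b == ι₁ y) ∨ (ι₁ a == ι₁ y ∧ ι₁ b == ι₁ x)) ∎
    where open ≡-Reasoning

  G₁-side-collapsible : Ore5 G₁ → OreCollapsible G R₁
  G₁-side-collapsible G₁-ore = record
    { proper  = boundary⇒proper G R₁ (copy-boundary z₁pos)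
    ; u       = ι₁ x
    ; v       = ι₁ y
    ; u≢v     = x≢y ∘ ι₁-injective
    ; nonadj  = trans (E-via (f-ι₁ x) (f-ι₁ y)) xy-deleted
    ; bd-u    = copy-boundary z₁pos
    ; bd-v    = copy-boundary z₂pos
    ; bd-only = R₁-boundary
    ; H       = G₁
    ; H-ore   = G₁-ore
    ; g       = ι₁
    ; g-inj   = λ _ _ → ι₁-injective
    ; g-in    = λ a → cong fromLeft (f-ι₁ a)
    ; g-surj  = R₁-surjective
    ; g-adj   = G₁-adj
    }

  contract : V → Fin (n G₂)
  contract (inj₁ _) = z
  contract (inj₂ b) = b

  E-ι₂ : ∀ c c≢z w → E G (ι₂ c c≢z) w ≡ Adj (inj₂ c) (f w)
  E-ι₂ c c≢z w = E-via (f-ι₂ c c≢z) refl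

  contract-adj : ∀ c t → Adj (inj₂ c) t ≡ true → E G₂ c (contract t) ≡ true
  contract-adj c (inj₁ a) edge = trans (Graph.sym G₂ c z) (proj₁ (cross-edge {a} edge))
  contract-adj c (inj₂ b) edge = edge

  contract-injective : ∀ c t₁ t₂ → t₁ ≢ inj₂ z → t₂ ≢ inj₂ z →
    Adj (inj₂ c) t₁ ≡ true → Adj (inj₂ c) t₂ ≡ true → contract t₁ ≡ contract t₂ → t₁ ≡ t₂
  contract-injective c (inj₁ a₁) (inj₁ a₂) _ _ e₁ e₂ _ =
    cong inj₁ (trans (proj₂ (cross-edge {a₁} e₁)) (sym (proj₂ (cross-edge {a₂} e₂))))
  contract-injective c (inj₂ b₁) (inj₂ b₂) _ _ _ _ e = cong inj₂ e
  contract-injective c (inj₁ a) (inj₂ b) _ t₂≢z _ _ e = ⊥-elim (t₂≢z (cong inj₂ (sym e)))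
  contract-injective c (inj₂ b) (inj₁ a) t₁≢z _ _ _ e = ⊥-elim (t₁≢z (cong inj₂ e))

  expand : Fin (n G₂) → Fin (n G₂) → V
  expand c b with b ≟ z
  ... | yes _ = inj₁ (port c)
  ... | no  _ = inj₂ b

  expand-≢z : ∀ c b → expand c b ≢ inj₂ z
  expand-≢z c b with b ≟ z
  ... | yes _   = λ ()
  ... | no  b≢z = b≢z ∘ inj₂-injective

  contract-expand : ∀ c b → contract (expand c b) ≡ b
  contract-expand c b with b ≟ z
  ... | yes b≡z = sym b≡z
  ... | no  _   = refl

  expand-adj : ∀ c b → E G₂ c b ≡ true → Adj (inj₂ c) (expand c b) ≡ true
  expand-adj c b cb with b ≟ z
  ... | yes refl = port-adj c (trans (Graph.sym G₂ z c) cb)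
  ... | no  _    = cb

  neighbour : Fin (n G₂) → Fin (n G₂) → Fin (n G)
  neighbour c b = vertex (expand c b) (expand-≢z c b)

  contract-neighbour : ∀ c b → contract (f (neighbour c b)) ≡ b
  contract-neighbour c b = trans (cong contract (f-vertex _ _)) (contract-expand c b)

  neighbour-adj : ∀ c c≢z b → E G₂ c b ≡ true → E G (ι₂ c c≢z) (neighbour c b) ≡ true
  neighbour-adj c c≢z b cb = trans (E-via (f-ι₂ c c≢z) (f-vertex _ _)) (expand-adj c b cb)

  adj-contract : ∀ c c≢z w → E G (ι₂ c c≢z) w ≡ true → E G₂ c (contract (f w)) ≡ true
  adj-contract c c≢z w cw = contract-adj c (f w) (trans (sym (E-ι₂ c c≢z w)) cw)

  deg-ι₂ : ∀ c c≢z → deg G (ι₂ c c≢z) ≡ deg G₂ c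
  deg-ι₂ c c≢z = begin
    deg G (ι₂ c c≢z)                ≡⟨ deg≡count G (ι₂ c c≢z) ⟩
    count (n G) (E G (ι₂ c c≢z))    ≡⟨ ≤-antisym contracting expanding ⟩
    count (n G₂) (E G₂ c)           ≡⟨ sym (deg≡count G₂ c) ⟩
    deg G₂ c                        ∎
    where
    open ≡-Reasoning
    adj : ∀ w → E G (ι₂ c c≢z) w ≡ true → Adj (inj₂ c) (f w) ≡ true
    adj w cw = trans (sym (E-ι₂ c c≢z w)) cw
    contracting : count (n G) (E G (ι₂ c c≢z)) ≤ count (n G₂) (E G₂ c)
    contracting = count-injection _ _ _ _ (λ w _ → contract (f w)) (adj-contract c c≢z)
      (λ w w' cw cw' e → f-inj w w'
         (contract-injective c (f w) (f w') (f-avoid w) (f-avoid w') (adj w cw) (adj w' cw') e))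
    expanding : count (n G₂) (E G₂ c) ≤ count (n G) (E G (ι₂ c c≢z))
    expanding = count-injection _ _ _ _ (λ b _ → neighbour c b) (neighbour-adj c c≢z)
      (λ b b' _ _ e → trans (sym (contract-neighbour c b))
                            (trans (cong (contract ∘ f) e) (contract-neighbour c b')))

  emerald-transfer : (Σ (Emerald G₂) λ K → ∀ i → Emerald.vtx K i ≢ z) →
                     ∀ {v a} → f v ≡ inj₁ a → Σ (Emerald G) λ K → ∀ i → Emerald.vtx K i ≢ v
  emerald-transfer (K , avoids-z) {v} fv =
    record
      { vtx     = vtx′
      ; vtx-inj = λ i j e → vtx-inj i j (ι₂-injective (avoids-z i) (avoids-z j) e)
      ; clique  = λ i j i≢j → trans (E-via (f-ι₂ _ (avoids-z i)) (f-ι₂ _ (avoids-z j)))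
                                    (clique i j i≢j)
      ; deg4    = λ i → trans (deg-ι₂ (vtx i) (avoids-z i)) (deg4 i)
      }
    , λ i vtx′≡v → inj₂≢inj₁ (trans (sym (f-ι₂ _ (avoids-z i))) (trans (cong f vtx′≡v) fv))
    where
    open Emerald K
    vtx′ : Fin 4 → Fin (n G)
    vtx′ i = ι₂ (vtx i) (avoids-z i)
    inj₂≢inj₁ : ∀ {a b} → inj₂ b ≢ inj₁ a
    inj₂≢inj₁ ()

  module Lift (R₂ : Fin (n G₂) → Bool) (R₂z : R₂ z ≡ false) where

    -- The vertices of G whose contraction lies in R₂; as R₂ avoids z, these
    -- are the vertices ι₂ b with b ∈ R₂.
    lift : Fin (n G) → Bool
    lift w = R₂ (contract (f w))

    lift-avoids : ∀ {w a} → f w ≡ inj₁ a → lift w ≡ false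
    lift-avoids fw = trans (cong (R₂ ∘ contract) fw) R₂z

    member≢z : ∀ {b} → R₂ b ≡ true → b ≢ z
    member≢z inR refl with trans (sym R₂z) inR
    ... | ()

    lift-member : ∀ t → R₂ (contract t) ≡ true → t ≡ inj₂ (contract t)
    lift-member (inj₁ a) inR = ⊥-elim (member≢z inR refl)
    lift-member (inj₂ b) inR = refl

    lift-ι₂ : ∀ b b≢z → lift (ι₂ b b≢z) ≡ R₂ b
    lift-ι₂ b b≢z = cong (R₂ ∘ contract) (f-ι₂ b b≢z)

    boundary-up : ∀ b b≢z → Boundary G₂ R₂ b → Boundary G lift (ι₂ b b≢z)
    boundary-up b b≢z (inR , w , outR , bw) =
      trans (lift-ι₂ b b≢z) inR , neighbour b w ,
      trans (cong R₂ (contract-neighbour b w)) outR , neighbour-adj b b≢z w bw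

    boundary-down : ∀ w → Boundary G lift w → Boundary G₂ R₂ (contract (f w))
    boundary-down w (inR , w' , outR , ww') =
      inR , contract (f w') , outR ,
      adj-contract (contract (f w)) (member≢z inR) w'
        (subst (λ u → E G u w' ≡ true) (ι₂-of (member≢z inR) fw) ww')
      where
      fw : f w ≡ inj₂ (contract (f w))
      fw = lift-member (f w) inR

    lifted-collapsible : OreCollapsible G₂ R₂ → OreCollapsible G lift
    lifted-collapsible col = record
      { proper  = ι₁ x , lift-avoids (f-ι₁ x)
      ; u       = ι₂ O.u u≢z
      ; v       = ι₂ O.v v≢z
      ; u≢v     = O.u≢v ∘ ι₂-injective u≢z v≢z
      ; nonadj  = trans (E-via (f-ι₂ _ u≢z) (f-ι₂ _ v≢z)) O.nonadj
      ; bd-u    = boundary-up _ u≢z O.bd-u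
      ; bd-v    = boundary-up _ v≢z O.bd-v
      ; bd-only = bd-only
      ; H       = O.H
      ; H-ore   = O.H-ore
      ; g       = g
      ; g-inj   = λ a b → O.g-inj a b ∘ ι₂-injective (g≢z a) (g≢z b)
      ; g-in    = λ a → trans (lift-ι₂ _ (g≢z a)) (O.g-in a)
      ; g-surj  = g-surj
      ; g-adj   = g-adj
      }
      where
      module O = OreCollapsible col
      u≢z : O.u ≢ z
      u≢z = member≢z (proj₁ O.bd-u)
      v≢z : O.v ≢ z
      v≢z = member≢z (proj₁ O.bd-v)
      g≢z : ∀ a → O.g a ≢ z
      g≢z a = member≢z (O.g-in a)
      g : Fin (n O.H) → Fin (n G)
      g a = ι₂ (O.g a) (g≢z a)

      bd-only : ∀ w → Boundary G lift w → w ≡ ι₂ O.u u≢z ⊎ w ≡ ι₂ O.v v≢z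
      bd-only w bd@(inR , _) =
        ⊎-map (λ b≡u → ι₂-of u≢z (trans fw (cong inj₂ b≡u)))
              (λ b≡v → ι₂-of v≢z (trans fw (cong inj₂ b≡v)))
              (O.bd-only _ (boundary-down w bd))
        where
        fw : f w ≡ inj₂ (contract (f w))
        fw = lift-member (f w) inR

      g-surj : ∀ w → lift w ≡ true → ∃ λ a → g a ≡ w
      g-surj w inR with O.g-surj _ inR
      ... | a , ga≡b = a , sym (ι₂-of (g≢z a) (trans (lift-member (f w) inR) (cong inj₂ (sym ga≡b))))

      g-adj : ∀ a b → E O.H a b ≡
        (E G (g a) (g b) ∨ ((g a == ι₂ O.u u≢z ∧ g b == ι₂ O.v v≢z) ∨
                            (g a == ι₂ O.v v≢z ∧ g b == ι₂ O.u u≢z)))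
      g-adj a b = trans (O.g-adj a b)
        (cong₂ _∨_ (sym (E-via (f-ι₂ _ (g≢z a)) (f-ι₂ _ (g≢z b))))
          (sym (cong₂ _∨_ (cong₂ _∧_ (ι₂-== _ _ (g≢z a) u≢z) (ι₂-== _ _ (g≢z b) v≢z))
                          (cong₂ _∧_ (ι₂-== _ _ (g≢z a) v≢z) (ι₂-== _ _ (g≢z b) u≢z)))))

lemma2p4 : (H : Graph) → Ore5 H → (v : Fin (n H)) →
    (∃ λ (R : Fin (n H) → Bool) → OreCollapsible H R × R v ≡ false)
    ⊎ (Σ (Emerald H) λ K → ∀ i → Emerald.vtx K i ≢ v)
lemma2p4 H (k5 .H five complete) v = inj₂ (K₅-emerald H five complete v)
lemma2p4 H (ore G₁ G₂ .H G₁-ore G₂-ore C) v with OreComposition.f C v in fv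
... | inj₂ _ = inj₁ (R₁ , G₁-side-collapsible G₁-ore , cong fromLeft fv)
  where open Composition C
... | inj₁ _ with lemma2p4 G₂ G₂-ore (OreComposition.z C)
...   | inj₂ emerald = inj₂ (emerald-transfer emerald fv)
  where open Composition C
...   | inj₁ (R₂ , R₂-collapsible , R₂z) =
  inj₁ (lift , lifted-collapsible R₂-collapsible , lift-avoids fv)
  where open Composition C
        open Lift R₂ R₂z
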